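{- Let $\sigma$ be a permutation avoiding $213$ and $231$ with factor decomposition $\sigma=F(m)\cdots F(1)$, let $\pi$ be a permutation of length $n$, let $2\le i\le m$ and $1\le j\le n$ with $\mathrm{SET}(i,j)\neq\emptyset$. Suppose $F(i)$ is an ascent (respectively descent) factor and let $s\in\mathrm{SET}(i,j)$ be such that the element of $s$ matching the leftmost element of $F(i-1)$ is minimal (respectively maximal) among all elements of $\mathrm{SET}(i,j)$. Then the following are equivalent: (a) there exists a matching of $\sigma$ in $\pi$ in which the leftmost element of $F(i)$ is matched to $\pi[j]$; (b) there exists a matching $t$ of $\sigma[1:\mathrm{LME}(F(i))-1]$ in $\pi[1:j-1]$ such that the concatenation $ts$ is a matching of $\sigma$ in $\pi$ in which the leftmost element of $F(i)$ is matched to $\pi[j]$.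
   Context: For a permutation $\pi$, $\pi[i]$ is its $i$-th entry, $\pi[i:j]=\pi[i]\cdots\pi[j]$ (empty if $j<i$), $\pi[i:]=\pi[i]\cdots\pi[n]$. A matching of a sequence $\tau$ of length $\ell$ in $\pi$ is a subsequence of $\pi$ of length $\ell$ with the same relative order as $\tau$; its $r$-th element is the element matching $\tau[r]$. For $\sigma$ of length $k$ and $1\le r<k$, $\sigma[r]$ is an ascent element if $\sigma[r]<\sigma[r+1]$, a descent element otherwise. Factor decomposition: partition positions $1,\dots,k-1$ into maximal intervals of consecutive positions whose elements are all ascent or all descent elements, append position $k$ to the last interval; the blocks are the factors, labelled right to left $F(1),\dots,F(m)$, so $\sigma=F(m)\cdots F(1)$; a factor is an ascent (resp. descent) factor if its elements other than $\sigma[k]$ are ascent (resp. descent) elements. $\mathrm{LME}(F(r))$ is the index in $\sigma$ of the leftmost element of $F(r)$. $\mathrm{SET}(i,j)$ is the set of subsequences $s$ of $\pi[j:]$ whose first element is $\pi[j]$ and which are matchings of $\sigma[\mathrm{LME}(F(i)):]=F(i)\cdots F(1)$. -}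

module Defs where

open import Data.Nat using (ℕ; zero; suc; _∸_; _≤_; _<_; _≤ᵇ_; _<ᵇ_; _≡ᵇ_)
open import Data.Bool using (Bool; true; false; _∧_; _∨_; _xor_)
open import Data.List using (List; []; _∷_; length; map; filter; upTo; take; drop; _++_)
open import Data.List.Relation.Binary.Permutation.Propositional using (_↭_)
open import Data.List.Relation.Binary.Sublist.Propositional using (_⊆_)
open import Data.Product using (_×_; ∃; ∃-syntax)
open import Data.Sum using (_⊎_)
open import Relation.Nullary using (¬_)
open import Relation.Binary.PropositionalEquality using (_≡_)
open import Function.Bundles using (_⇔_)
open import Data.Bool using (T)

-- 0-based lookup with default 0 (only ever used in range)
nth : List ℕ → ℕ → ℕ
nth []       _       = 0
nth (x ∷ xs) zero    = x
nth (x ∷ xs) (suc r) = nth xs r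

at : List ℕ → ℕ → ℕ
at xs r = nth xs (r ∸ 1)

IsPerm : ℕ → List ℕ → Set
IsPerm n xs = xs ↭ map suc (upTo n)

SameOrder : List ℕ → List ℕ → Set
SameOrder xs ys = length xs ≡ length ys ×
  (∀ a b → a < length xs → b < length xs → (nth xs a < nth xs b ⇔ nth ys a < nth ys b))

IsMatching : List ℕ → List ℕ → List ℕ → Set
IsMatching τ π u = u ⊆ π × SameOrder τ u

Avoids : List ℕ → List ℕ → Set
Avoids σ τ = ¬ (∃[ u ] IsMatching τ σ u)

Asc : List ℕ → ℕ → Set
Asc σ r = at σ r < at σ (suc r)

ascᵇ : List ℕ → ℕ → Bool
ascᵇ σ r = at σ r <ᵇ at σ (suc r)

isStartᵇ : List ℕ → ℕ → Bool
isStartᵇ σ r = (r ≡ᵇ 1) ∨ ((2 ≤ᵇ r) ∧ (r <ᵇ length σ) ∧ (ascᵇ σ (r ∸ 1) xor ascᵇ σ r))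

-- increasing list of the (1-based) leftmost positions of the factors
starts : List ℕ → List ℕ
starts σ = filter (λ r → T? (isStartᵇ σ r)) (map suc (upTo (length σ)))
  where
  open import Relation.Nullary.Decidable using (Dec)
  open import Data.Bool.Properties using (T?)

numFactors : List ℕ → ℕ
numFactors σ = length (starts σ)

-- LME(F(i)): factors labelled right to left, F(1) rightmost
LME : List ℕ → ℕ → ℕ
LME σ i = nth (starts σ) (numFactors σ ∸ i)

InFactor : List ℕ → ℕ → ℕ → Set
InFactor σ i r = LME σ i ≤ r × r ≤ length σ × (i ≡ 1 ⊎ r < LME σ (i ∸ 1))

AscentFactor : List ℕ → ℕ → Set
AscentFactor σ i = ∀ r → InFactor σ i r → r < length σ → Asc σ r

DescentFactor : List ℕ → ℕ → Set
DescentFactor σ i = ∀ r → InFactor σ i r → r < length σ → ¬ Asc σ r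

InSET : List ℕ → List ℕ → ℕ → ℕ → List ℕ → Set
InSET σ π i j s = s ⊆ drop (j ∸ 1) π × at s 1 ≡ at π j × 0 < length s
                × SameOrder (drop (LME σ i ∸ 1) σ) s

-- element of s ∈ SET(i,j) matching the leftmost element of F(i-1)
elemF : List ℕ → ℕ → List ℕ → ℕ
elemF σ i s = at s (suc (LME σ (i ∸ 1) ∸ LME σ i))

CondA : List ℕ → List ℕ → ℕ → ℕ → Set
CondA σ π i j = ∃[ u ] (IsMatching σ π u × at u (LME σ i) ≡ at π j)

CondB : List ℕ → List ℕ → ℕ → ℕ → List ℕ → Set
CondB σ π i j s = ∃[ t ] (IsMatching (take (LME σ i ∸ 1) σ) (take (j ∸ 1) π) t
                         × IsMatching σ π (t ++ s) × at (t ++ s) (LME σ i) ≡ at π j)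

pat213 pat231 : List ℕ
pat213 = 2 ∷ 1 ∷ 3 ∷ []
pat231 = 2 ∷ 3 ∷ 1 ∷ []

-- In a permutation avoiding 213 and 231 every entry except the last is either
-- smaller than all later entries (an ascent element) or larger than all of them
-- (a descent element).  Hence if F(i) is an ascent factor, the suffix
-- F(i)⋯F(1) has its minimum at LME(F(i)) and its maximum at LME(F(i-1)) (the
-- other way round for a descent factor).  Given a matching u of σ with
-- LME(F(i)) matched to π[j], cut u there: its tail lies in SET(i,j).  Replacing
-- the tail by s keeps the minimum (both start at π[j]) and does not raise the
-- maximum (by the choice of s), so every entry of the head of u, being below or
-- above all of the tail of u, stays below or above all of s, and the spliced
-- sequence is still a matching of σ.
module Submission where

open import Defs
open import Data.Nat using (ℕ; zero; suc; _+_; _∸_; _≤_; _<_; _⊓_; z≤n; s≤s; s≤s⁻¹; z<s; s<s; _<?_)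
open import Data.Nat.Properties
open import Data.Bool using (true; false; T; _xor_)
open import Data.Bool.Properties using (T?; T-∧)
open import Data.Unit using (tt)
open import Data.Empty using (⊥; ⊥-elim)
open import Data.List using (List; []; _∷_; length; map; upTo; take; drop; _++_)
open import Data.List.Properties
  using (length-take; length-drop; length-++; take++drop≡id; length-map; length-upTo)
open import Data.List.Membership.Propositional using (_∈_)
open import Data.List.Membership.Propositional.Properties using (∈-filter⁻)
open import Data.List.Relation.Unary.Any using (here; there)
import Data.List.Relation.Unary.All as All
open import Data.List.Relation.Unary.All.Properties using (All¬⇒¬Any)
open import Data.List.Relation.Unary.AllPairs as AllPairs using (AllPairs; []; _∷_)
import Data.List.Relation.Unary.AllPairs.Properties as AllPairsₚ
open import Data.List.Relation.Unary.Unique.Propositional using (Unique)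
open import Data.List.Relation.Binary.Sublist.Propositional using (_⊆_; []; _∷_; _∷ʳ_; minimum)
open import Data.List.Relation.Binary.Sublist.Propositional.Properties using (++⁺; Any-resp-⊆)
open import Data.List.Relation.Binary.Permutation.Propositional using (↭-sym; ↭⇒↭ₛ)
open import Data.List.Relation.Binary.Permutation.Propositional.Properties using (↭-length)
open import Data.Product using (_×_; _,_; proj₁; proj₂; ∃-syntax)
open import Data.Sum using (_⊎_; inj₁; inj₂; swap)
open import Relation.Nullary using (¬_; yes; no)
open import Relation.Binary using (tri<; tri≈; tri>)
open import Relation.Binary.PropositionalEquality
  using (_≡_; _≢_; refl; sym; trans; cong; subst; subst₂; setoid; module ≡-Reasoning)
open import Data.List.Relation.Binary.Permutation.Setoid.Properties (setoid ℕ) using (Unique-resp-↭)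
open import Function.Base using (_∘_)
open import Function.Bundles using (_⇔_; mk⇔; Equivalence)

nth-∈ : ∀ xs {a} → a < length xs → nth xs a ∈ xs
nth-∈ (x ∷ xs) {zero}  _       = here refl
nth-∈ (x ∷ xs) {suc a} (s≤s a<) = there (nth-∈ xs a<)

nth-take : ∀ xs n {a} → a < n → nth (take n xs) a ≡ nth xs a
nth-take []       zero    _        = refl
nth-take []       (suc n) _        = refl
nth-take (x ∷ xs) (suc n) {zero}  _        = refl
nth-take (x ∷ xs) (suc n) {suc a} (s≤s a<n) = nth-take xs n a<n

nth-drop : ∀ xs n a → nth (drop n xs) a ≡ nth xs (n + a)
nth-drop xs       zero    a = refl
nth-drop []       (suc n) a = refl
nth-drop (x ∷ xs) (suc n) a = nth-drop xs n a

nth-drop-∸ : ∀ xs {n a} → n ≤ a → nth (drop n xs) (a ∸ n) ≡ nth xs a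
nth-drop-∸ xs {n} {a} n≤a = trans (nth-drop xs n (a ∸ n)) (cong (nth xs) (m+[n∸m]≡n n≤a))

nth-++ˡ : ∀ xs ys {a} → a < length xs → nth (xs ++ ys) a ≡ nth xs a
nth-++ˡ (x ∷ xs) ys {zero}  _       = refl
nth-++ˡ (x ∷ xs) ys {suc a} (s≤s a<) = nth-++ˡ xs ys a<

nth-++ʳ : ∀ xs ys a → nth (xs ++ ys) (length xs + a) ≡ nth ys a
nth-++ʳ []       ys a = refl
nth-++ʳ (x ∷ xs) ys a = nth-++ʳ xs ys a

nth-injective : ∀ {xs a b} → Unique xs → a < length xs → b < length xs → nth xs a ≡ nth xs b → a ≡ b
nth-injective {x ∷ xs} {zero}  {zero}  _          _        _        _ = refl
nth-injective {x ∷ xs} {zero}  {suc b} (x∉ ∷ _)   _        (s≤s b<) e =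
  ⊥-elim (All¬⇒¬Any x∉ (subst (_∈ xs) (sym e) (nth-∈ xs b<)))
nth-injective {x ∷ xs} {suc a} {zero}  (x∉ ∷ _)   (s≤s a<) _        e =
  ⊥-elim (All¬⇒¬Any x∉ (subst (_∈ xs) e (nth-∈ xs a<)))
nth-injective {x ∷ xs} {suc a} {suc b} (_ ∷ uniq) (s≤s a<) (s≤s b<) e =
  cong suc (nth-injective uniq a< b< e)

length-take-≤ : ∀ (xs : List ℕ) {n} → n ≤ length xs → length (take n xs) ≡ n
length-take-≤ xs {n} n≤ = trans (length-take n xs) (m≤n⇒m⊓n≡m n≤)

<-length-drop : ∀ (xs : List ℕ) {n a} → n + a < length xs → a < length (drop n xs)
<-length-drop xs       {zero}  lt       = lt
<-length-drop (x ∷ xs) {suc n} (s≤s lt) = <-length-drop xs lt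

∸-<-length-drop : ∀ (xs : List ℕ) {n a} → n ≤ a → a < length xs → a ∸ n < length (drop n xs)
∸-<-length-drop xs n≤a a< = <-length-drop xs (subst (_< length xs) (sym (m+[n∸m]≡n n≤a)) a<)

nth-++-length : ∀ xs {ys : List ℕ} {n} → length xs ≡ n → nth (xs ++ ys) n ≡ nth ys 0
nth-++-length []       refl = refl
nth-++-length (x ∷ xs) refl = nth-++-length xs refl

+-<-length : ∀ (xs : List ℕ) {n a} → a < length (drop n xs) → n + a < length xs
+-<-length xs       {zero}  a< = a<
+-<-length (x ∷ xs) {suc n} a< = s≤s (+-<-length xs a<)

⊆-splitAt : ∀ {u π a J} → Unique π → u ⊆ π → a < length u → J < length π → nth u a ≡ nth π J
          → take a u ⊆ take J π × drop a u ⊆ drop J π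
⊆-splitAt {u} {y ∷ π} {a} {zero}  (y∉ ∷ _) (.y ∷ʳ u⊆) a< _ e =
  ⊥-elim (All¬⇒¬Any y∉ (subst (_∈ π) e (Any-resp-⊆ u⊆ (nth-∈ u a<))))
⊆-splitAt {π = y ∷ π} {a} {suc J} (_ ∷ uniq) (.y ∷ʳ u⊆) a< (s≤s J<) e =
  let (before , after) = ⊆-splitAt uniq u⊆ a< J< e in y ∷ʳ before , after
⊆-splitAt {π = y ∷ π} {zero}  {zero}  _ (refl ∷ u⊆) _ _ _ = [] , refl ∷ u⊆
⊆-splitAt {π = y ∷ π} {zero}  {suc J} (y∉ ∷ _) (refl ∷ _) _ (s≤s J<) e =
  ⊥-elim (All¬⇒¬Any y∉ (subst (_∈ π) (sym e) (nth-∈ π J<)))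
⊆-splitAt {_ ∷ u} {y ∷ π} {suc a} {zero}  (y∉ ∷ _) (refl ∷ u⊆) (s≤s a<) _ e =
  ⊥-elim (All¬⇒¬Any y∉ (subst (_∈ π) e (Any-resp-⊆ u⊆ (nth-∈ u a<))))
⊆-splitAt {π = y ∷ π} {suc a} {suc J} (_ ∷ uniq) (refl ∷ u⊆) (s≤s a<) (s≤s J<) e =
  let (before , after) = ⊆-splitAt uniq u⊆ a< J< e in refl ∷ before , after

-- Order isomorphism

Concordant : ℕ → ℕ → ℕ → ℕ → Set
Concordant x y x′ y′ = (x < y × x′ < y′) ⊎ (y < x × y′ < x′)

concordant-sym : ∀ {x y x′ y′} → Concordant x y x′ y′ → Concordant y x y′ x′
concordant-sym = swap

concordant⇒<⇔< : ∀ {x y x′ y′} → Concordant x y x′ y′ → (x < y ⇔ x′ < y′)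
concordant⇒<⇔< (inj₁ (x<y , x′<y′)) = mk⇔ (λ _ → x′<y′) (λ _ → x<y)
concordant⇒<⇔< (inj₂ (y<x , y′<x′)) =
  mk⇔ (λ x<y → ⊥-elim (<-asym x<y y<x)) (λ x′<y′ → ⊥-elim (<-asym x′<y′ y′<x′))

<⇔<-irrefl : ∀ {x y} → (x < x ⇔ y < y)
<⇔<-irrefl = mk⇔ (λ x<x → ⊥-elim (<-irrefl refl x<x)) (λ y<y → ⊥-elim (<-irrefl refl y<y))

<⇔<-cong : ∀ {x x₁ y y₁ z z₁ w w₁} → x ≡ x₁ → y ≡ y₁ → z ≡ z₁ → w ≡ w₁
         → (x₁ < y₁ ⇔ z₁ < w₁) → (x < y ⇔ z < w)
<⇔<-cong refl refl refl refl iff = iff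

sameOrder-< : ∀ {xs ys a b} → SameOrder xs ys → a < length xs → b < length xs
            → nth xs a < nth xs b → nth ys a < nth ys b
sameOrder-< (_ , ord) a< b< = Equivalence.to (ord _ _ a< b<)

sameOrder-≤ : ∀ {xs ys a b} → SameOrder xs ys → a < length xs → b < length xs
            → nth xs a ≤ nth xs b → nth ys a ≤ nth ys b
sameOrder-≤ (_ , ord) a< b< xa≤xb = ≮⇒≥ (λ yb<ya → <⇒≱ (Equivalence.from (ord _ _ b< a<) yb<ya) xa≤xb)

sameOrder-triple : ∀ {p q r x y z} → Concordant p q x y → Concordant p r x z → Concordant q r y z
                 → SameOrder (p ∷ q ∷ r ∷ []) (x ∷ y ∷ z ∷ [])
sameOrder-triple {p} {q} {r} {x} {y} {z} pq pr qr = refl , ord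
  where
  pqr xyz : List ℕ
  pqr = p ∷ q ∷ r ∷ []
  xyz = x ∷ y ∷ z ∷ []
  ord : ∀ a b → a < 3 → b < 3 → (nth pqr a < nth pqr b ⇔ nth xyz a < nth xyz b)
  ord 0 0 _ _ = <⇔<-irrefl
  ord 0 1 _ _ = concordant⇒<⇔< pq
  ord 0 2 _ _ = concordant⇒<⇔< pr
  ord 1 0 _ _ = concordant⇒<⇔< (concordant-sym pq)
  ord 1 1 _ _ = <⇔<-irrefl
  ord 1 2 _ _ = concordant⇒<⇔< qr
  ord 2 0 _ _ = concordant⇒<⇔< (concordant-sym pr)
  ord 2 1 _ _ = concordant⇒<⇔< (concordant-sym qr)
  ord 2 2 _ _ = <⇔<-irrefl
  ord (suc (suc (suc _))) _ (s≤s (s≤s (s≤s ()))) _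
  ord _ (suc (suc (suc _))) _ (s≤s (s≤s (s≤s ())))

sameOrder-213 : ∀ {x y z} → y < x → x < z → SameOrder pat213 (x ∷ y ∷ z ∷ [])
sameOrder-213 y<x x<z =
  sameOrder-triple (inj₂ (s<s z<s , y<x)) (inj₁ (s<s (s<s z<s) , x<z)) (inj₁ (s<s z<s , <-trans y<x x<z))

sameOrder-231 : ∀ {x y z} → y < x → x < z → SameOrder pat231 (x ∷ z ∷ y ∷ [])
sameOrder-231 y<x x<z =
  sameOrder-triple (inj₁ (s<s (s<s z<s) , x<z)) (inj₂ (s<s z<s , y<x)) (inj₂ (s<s z<s , <-trans y<x x<z))

sameOrder-take : ∀ {xs ys} n → SameOrder xs ys → SameOrder (take n xs) (take n ys)
sameOrder-take {xs} {ys} n (len , ord) = lenₙ , ordₙ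
  where
  lenₙ : length (take n xs) ≡ length (take n ys)
  lenₙ = trans (length-take n xs) (trans (cong (n ⊓_) len) (sym (length-take n ys)))
  within : ∀ {a} → a < length (take n xs) → a < n × a < length xs
  within a< = let a<n⊓ = subst (_ <_) (length-take n xs) a< in m<n⊓o⇒m<n n _ a<n⊓ , m<n⊓o⇒m<o n _ a<n⊓
  ordₙ : ∀ a b → a < length (take n xs) → b < length (take n xs)
       → (nth (take n xs) a < nth (take n xs) b ⇔ nth (take n ys) a < nth (take n ys) b)
  ordₙ a b a< b< =
    let (a<n , a<xs) = within a<
        (b<n , b<xs) = within b<
    in <⇔<-cong (nth-take xs n a<n) (nth-take xs n b<n) (nth-take ys n a<n) (nth-take ys n b<n)
                (ord a b a<xs b<xs)

sameOrder-drop : ∀ {xs ys} n → SameOrder xs ys → SameOrder (drop n xs) (drop n ys)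
sameOrder-drop {xs} {ys} n (len , ord) = lenₙ , ordₙ
  where
  lenₙ : length (drop n xs) ≡ length (drop n ys)
  lenₙ = trans (length-drop n xs) (trans (cong (_∸ n) len) (sym (length-drop n ys)))
  ordₙ : ∀ a b → a < length (drop n xs) → b < length (drop n xs)
       → (nth (drop n xs) a < nth (drop n xs) b ⇔ nth (drop n ys) a < nth (drop n ys) b)
  ordₙ a b a< b< = <⇔<-cong (nth-drop xs n a) (nth-drop xs n b) (nth-drop ys n a) (nth-drop ys n b)
                            (ord (n + a) (n + b) (+-<-length xs a<) (+-<-length xs b<))

sameOrder-++ : ∀ {σ t s L} → length t ≡ L → SameOrder (take L σ) t → SameOrder (drop L σ) s
             → (∀ a b → a < L → b < length s → Concordant (nth σ a) (nth σ (L + b)) (nth t a) (nth s b))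
             → SameOrder σ (t ++ s)
sameOrder-++ {σ} {t} {s} refl (lenₜ , ordₜ) (lenₛ , ordₛ) across = len , ord
  where
  L = length t
  L≤σ : L ≤ length σ
  L≤σ = subst (_≤ length σ) (trans (sym (length-take L σ)) lenₜ) (m⊓n≤n L (length σ))
  len : length σ ≡ length (t ++ s)
  len = begin
    length σ               ≡⟨ sym (m+[n∸m]≡n L≤σ) ⟩
    L + (length σ ∸ L)     ≡⟨ cong (L +_) (trans (sym (length-drop L σ)) lenₛ) ⟩
    L + length s           ≡⟨ sym (length-++ t) ⟩
    length (t ++ s)        ∎
    where open ≡-Reasoning
  locate : ∀ a → a < length σ → a < L ⊎ ∃[ b ] (a ≡ L + b × b < length s)
  locate a a< with a <? L
  ... | yes a<L = inj₁ a<L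
  ... | no  a≮L = let (b , L+b≡a) = m≤n⇒∃[o]m+o≡n (≮⇒≥ a≮L) in
    inj₂ (b , sym L+b≡a , subst (b <_) lenₛ (<-length-drop σ (subst (_< length σ) (sym L+b≡a) a<)))
  inₜ : ∀ {a} → a < L → a < length (take L σ)
  inₜ = subst (_ <_) (sym lenₜ)
  inₛ : ∀ {b} → b < length s → b < length (drop L σ)
  inₛ = subst (_ <_) (sym lenₛ)
  ord : ∀ a b → a < length σ → b < length σ → (nth σ a < nth σ b ⇔ nth (t ++ s) a < nth (t ++ s) b)
  ord a b a< b< with locate a a< | locate b b<
  ... | inj₁ a<L | inj₁ b<L =
    <⇔<-cong (sym (nth-take σ L a<L)) (sym (nth-take σ L b<L)) (nth-++ˡ t s a<L) (nth-++ˡ t s b<L)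
             (ordₜ a b (inₜ a<L) (inₜ b<L))
  ... | inj₂ (a′ , refl , a′<) | inj₂ (b′ , refl , b′<) =
    <⇔<-cong (sym (nth-drop σ L a′)) (sym (nth-drop σ L b′)) (nth-++ʳ t s a′) (nth-++ʳ t s b′)
             (ordₛ a′ b′ (inₛ a′<) (inₛ b′<))
  ... | inj₁ a<L | inj₂ (b′ , refl , b′<) =
    <⇔<-cong refl refl (nth-++ˡ t s a<L) (nth-++ʳ t s b′) (concordant⇒<⇔< (across a b′ a<L b′<))
  ... | inj₂ (a′ , refl , a′<) | inj₁ b<L =
    <⇔<-cong refl refl (nth-++ʳ t s a′) (nth-++ˡ t s b<L) (concordant⇒<⇔< (concordant-sym (across b a′ b<L a′<)))

-- Splicing

BelowLater AboveLater : List ℕ → ℕ → Set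
BelowLater σ a = ∀ c → a < c → c < length σ → nth σ a < nth σ c
AboveLater σ a = ∀ c → a < c → c < length σ → nth σ c < nth σ a

record LeastFrom (σ : List ℕ) (L p : ℕ) : Set where
  field
    from    : L ≤ p
    bounded : p < length σ
    least   : ∀ c → L ≤ c → c < length σ → nth σ p ≤ nth σ c

record GreatestFrom (σ : List ℕ) (L p : ℕ) : Set where
  field
    from     : L ≤ p
    bounded  : p < length σ
    greatest : ∀ c → L ≤ c → c < length σ → nth σ c ≤ nth σ p

leastFrom⇒least : ∀ {σ s L p} → SameOrder (drop L σ) s → LeastFrom σ L p
                → ∀ b → b < length s → nth s (p ∸ L) ≤ nth s b
leastFrom⇒least {σ} {s} {L} σ↓≅s lo b b< =
  sameOrder-≤ {drop L σ} {s} σ↓≅s (∸-<-length-drop σ from bounded) b<σ↓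
    (subst₂ _≤_ (sym (nth-drop-∸ σ from)) (sym (nth-drop σ L b))
                (least (L + b) (m≤m+n L b) (+-<-length σ b<σ↓)))
  where
  open LeastFrom lo
  b<σ↓ : b < length (drop L σ)
  b<σ↓ = subst (b <_) (sym (proj₁ σ↓≅s)) b<

greatestFrom⇒greatest : ∀ {σ s L p} → SameOrder (drop L σ) s → GreatestFrom σ L p
                      → ∀ b → b < length s → nth s b ≤ nth s (p ∸ L)
greatestFrom⇒greatest {σ} {s} {L} σ↓≅s hi b b< =
  sameOrder-≤ {drop L σ} {s} σ↓≅s b<σ↓ (∸-<-length-drop σ from bounded)
    (subst₂ _≤_ (sym (nth-drop σ L b)) (sym (nth-drop-∸ σ from))
                (greatest (L + b) (m≤m+n L b) (+-<-length σ b<σ↓)))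
  where
  open GreatestFrom hi
  b<σ↓ : b < length (drop L σ)
  b<σ↓ = subst (b <_) (sym (proj₁ σ↓≅s)) b<

module Splice {σ u s : List ℕ} {L plo phi : ℕ}
  (σ≅u : SameOrder σ u) (σ↓≅s : SameOrder (drop L σ) s)
  (lo : LeastFrom σ L plo) (hi : GreatestFrom σ L phi)
  (u≤s : nth u plo ≤ nth s (plo ∸ L)) (s≤u : nth s (phi ∸ L) ≤ nth u phi)
  (extreme : ∀ {a} → suc a < length σ → BelowLater σ a ⊎ AboveLater σ a) where

  open LeastFrom lo using () renaming (from to L≤plo; bounded to plo<)
  open GreatestFrom hi using () renaming (from to L≤phi; bounded to phi<)

  concordant-across : ∀ a b → a < L → b < length s
                    → Concordant (nth σ a) (nth σ (L + b)) (nth u a) (nth s b)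
  concordant-across a b a<L b< = by-extremality (extreme (≤-<-trans (≤-trans a<L L≤plo) plo<))
    where
    open ≤-Reasoning
    a< : a < length σ
    a< = <-trans (<-≤-trans a<L L≤plo) plo<
    a<L+b : a < L + b
    a<L+b = <-≤-trans a<L (m≤m+n L b)
    L+b< : L + b < length σ
    L+b< = +-<-length σ (subst (b <_) (sym (proj₁ σ↓≅s)) b<)
    by-extremality : BelowLater σ a ⊎ AboveLater σ a → Concordant (nth σ a) (nth σ (L + b)) (nth u a) (nth s b)
    by-extremality (inj₁ below) = inj₁ (below (L + b) a<L+b L+b< , (begin-strict
      nth u a          <⟨ sameOrder-< {σ} {u} σ≅u a< plo< (below plo (<-≤-trans a<L L≤plo) plo<) ⟩
      nth u plo        ≤⟨ u≤s ⟩
      nth s (plo ∸ L)  ≤⟨ leastFrom⇒least {s = s} σ↓≅s lo b b< ⟩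
      nth s b          ∎))
    by-extremality (inj₂ above) = inj₂ (above (L + b) a<L+b L+b< , (begin-strict
      nth s b          ≤⟨ greatestFrom⇒greatest {s = s} σ↓≅s hi b b< ⟩
      nth s (phi ∸ L)  ≤⟨ s≤u ⟩
      nth u phi        <⟨ sameOrder-< {σ} {u} σ≅u phi< a< (above phi (<-≤-trans a<L L≤phi) phi<) ⟩
      nth u a          ∎))

  sameOrder-splice : SameOrder σ (take L u ++ s)
  sameOrder-splice =
    sameOrder-++ {σ} {take L u} {s} (length-take-≤ u L≤u) (sameOrder-take {σ} {u} L σ≅u) σ↓≅s across
    where
    L≤u : L ≤ length u
    L≤u = subst (L ≤_) (proj₁ σ≅u) (≤-trans L≤plo (<⇒≤ plo<))
    across : ∀ a b → a < L → b < length s → Concordant (nth σ a) (nth σ (L + b)) (nth (take L u) a) (nth s b)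
    across a b a<L b< = subst (λ x → Concordant (nth σ a) (nth σ (L + b)) x (nth s b))
                              (sym (nth-take u L a<L)) (concordant-across a b a<L b<)

-- SET(i,j) and conditions (a) and (b)

-- The notions of Defs with LME(F(i)) = L and LME(F(i-1)) = P as parameters
-- (1-based, like j): InSET σ π i j is InSETAt σ π (LME σ i) j, and so on.
InSETAt : List ℕ → List ℕ → ℕ → ℕ → List ℕ → Set
InSETAt σ π L j s = s ⊆ drop (j ∸ 1) π × at s 1 ≡ at π j × 0 < length s × SameOrder (drop (L ∸ 1) σ) s

CondAAt : List ℕ → List ℕ → ℕ → ℕ → Set
CondAAt σ π L j = ∃[ u ] (IsMatching σ π u × at u L ≡ at π j)

CondBAt : List ℕ → List ℕ → ℕ → ℕ → List ℕ → Set
CondBAt σ π L j s = ∃[ t ] (IsMatching (take (L ∸ 1) σ) (take (j ∸ 1) π) t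
                          × IsMatching σ π (t ++ s) × at (t ++ s) L ≡ at π j)

elemFAt : ℕ → ℕ → List ℕ → ℕ
elemFAt L P s = at s (suc (P ∸ L))

condB⇒condA : ∀ {σ π L j s} → CondBAt σ π L j s → CondAAt σ π L j
condB⇒condA {s = s} (t , _ , ts-matching , ts[L]≡π[j]) = t ++ s , ts-matching , ts[L]≡π[j]

drop-∈SET : ∀ {σ π u L0 j′} → Unique π → IsMatching σ π u → L0 < length σ → j′ < length π
          → nth u L0 ≡ nth π j′ → InSETAt σ π (suc L0) (suc j′) (drop L0 u)
drop-∈SET {σ} {π} {u} {L0} π-unique (u⊆π , σ≅u) L0< j′< u[L0]≡π[j′] =
  proj₂ (⊆-splitAt π-unique u⊆π L0<u j′< u[L0]≡π[j′]) ,
  trans (nth-drop u L0 0) (trans (cong (nth u) (+-identityʳ L0)) u[L0]≡π[j′]) ,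
  subst (0 <_) (sym (length-drop L0 u)) (m<n⇒0<n∸m L0<u) ,
  sameOrder-drop {σ} {u} L0 σ≅u
  where
  L0<u : L0 < length u
  L0<u = subst (L0 <_) (proj₁ σ≅u) L0<

matching-head≡SET-head : ∀ {σ π u L0 j′ s} → InSETAt σ π (suc L0) (suc j′) s
                       → nth u L0 ≡ nth π j′ → nth u L0 ≡ nth s (L0 ∸ L0)
matching-head≡SET-head {π = π} {u} {L0} {j′} {s} (_ , s-head , _) u[L0]≡π[j′] = begin
  nth u L0        ≡⟨ u[L0]≡π[j′] ⟩
  nth π j′        ≡⟨ sym s-head ⟩
  nth s 0         ≡⟨ cong (nth s) (sym (n∸n≡0 L0)) ⟩
  nth s (L0 ∸ L0) ∎
  where open ≡-Reasoning

condA⇒condB : ∀ {σ π L0 j′ s plo phi} → Unique π → j′ < length π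
  → LeastFrom σ L0 plo → GreatestFrom σ L0 phi
  → (∀ {a} → suc a < length σ → BelowLater σ a ⊎ AboveLater σ a)
  → InSETAt σ π (suc L0) (suc j′) s
  → (∀ u → IsMatching σ π u → nth u L0 ≡ nth π j′ → nth u plo ≤ nth s (plo ∸ L0) × nth s (phi ∸ L0) ≤ nth u phi)
  → CondAAt σ π (suc L0) (suc j′) → CondBAt σ π (suc L0) (suc j′) s
condA⇒condB {σ} {π} {L0} {j′} {s} π-unique j′< lo hi extreme (s⊆ , s-head , _ , σ↓≅s) bounds
            (u , u-matching@(u⊆π , σ≅u) , u[L0]≡π[j′]) =
  take L0 u , (before , sameOrder-take {σ} {u} L0 σ≅u) , (spliced⊆π , sameOrder-splice) , spliced-head
  where
  u-bounds = bounds u u-matching u[L0]≡π[j′]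
  open Splice {u = u} {s = s} σ≅u σ↓≅s lo hi (proj₁ u-bounds) (proj₂ u-bounds) extreme
  L0<u : L0 < length u
  L0<u = subst (L0 <_) (proj₁ σ≅u) (≤-<-trans (LeastFrom.from lo) (LeastFrom.bounded lo))
  before : take L0 u ⊆ take j′ π
  before = proj₁ (⊆-splitAt π-unique u⊆π L0<u j′< u[L0]≡π[j′])
  spliced⊆π : take L0 u ++ s ⊆ π
  spliced⊆π = subst (take L0 u ++ s ⊆_) (take++drop≡id j′ π) (++⁺ before s⊆)
  spliced-head : nth (take L0 u ++ s) L0 ≡ nth π j′
  spliced-head = trans (nth-++-length (take L0 u) (length-take-≤ u (<⇒≤ L0<u))) s-head

-- Permutations avoiding 213 and 231

singleton-nth-⊆ : ∀ xs {c} → c < length xs → nth xs c ∷ [] ⊆ xs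
singleton-nth-⊆ (x ∷ xs) {zero}  _       = refl ∷ minimum xs
singleton-nth-⊆ (x ∷ xs) {suc c} (s≤s c<) = x ∷ʳ singleton-nth-⊆ xs c<

pair-nth-⊆ : ∀ xs {b c} → b < c → c < length xs → nth xs b ∷ nth xs c ∷ [] ⊆ xs
pair-nth-⊆ (x ∷ xs) {zero}  {suc c} _         (s≤s c<) = refl ∷ singleton-nth-⊆ xs c<
pair-nth-⊆ (x ∷ xs) {suc b} {suc c} (s≤s b<c) (s≤s c<) = x ∷ʳ pair-nth-⊆ xs b<c c<

triple-nth-⊆ : ∀ xs {a b c} → a < b → b < c → c < length xs → nth xs a ∷ nth xs b ∷ nth xs c ∷ [] ⊆ xs
triple-nth-⊆ (x ∷ xs) {zero}  {suc b} {suc c} _         (s≤s b<c) (s≤s c<) = refl ∷ pair-nth-⊆ xs b<c c<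
triple-nth-⊆ (x ∷ xs) {suc a} {suc b} {suc c} (s≤s a<b) (s≤s b<c) (s≤s c<) = x ∷ʳ triple-nth-⊆ xs a<b b<c c<

module Avoiding {σ : List ℕ} (σ-unique : Unique σ)
                (avoids-213 : Avoids σ pat213) (avoids-231 : Avoids σ pat231) where

  no-straddle : ∀ {r b c} → r < b → r < c → b < length σ → c < length σ
              → nth σ b < nth σ r → nth σ r < nth σ c → ⊥
  no-straddle {r} {b} {c} r<b r<c b< c< below above with <-cmp b c
  ... | tri< b<c _ _  = avoids-213 (_ , triple-nth-⊆ σ r<b b<c c< , sameOrder-213 below above)
  ... | tri≈ _ refl _ = <-asym below above
  ... | tri> _ _ c<b  = avoids-231 (_ , triple-nth-⊆ σ r<c c<b b< , sameOrder-231 below above)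

  nth-distinct : ∀ {a c} → a < c → c < length σ → nth σ a ≢ nth σ c
  nth-distinct a<c c< e = <-irrefl (nth-injective σ-unique (<-trans a<c c<) c< e) a<c

  ascent⇒belowLater : ∀ {a} → suc a < length σ → nth σ a < nth σ (suc a) → BelowLater σ a
  ascent⇒belowLater a+1< ascent c a<c c< =
    ≤∧≢⇒< (≮⇒≥ (λ c-below → no-straddle a<c ≤-refl c< a+1< c-below ascent)) (nth-distinct a<c c<)

  descent⇒aboveLater : ∀ {a} → suc a < length σ → ¬ nth σ a < nth σ (suc a) → AboveLater σ a
  descent⇒aboveLater {a} a+1< descent c a<c c< =
    ≤∧≢⇒< (≮⇒≥ (λ c-above → no-straddle ≤-refl a<c a+1< c< next-below c-above)) (nth-distinct a<c c< ∘ sym)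
    where
    next-below : nth σ (suc a) < nth σ a
    next-below = ≤∧≢⇒< (≮⇒≥ descent) (nth-distinct ≤-refl a+1< ∘ sym)

  belowLater⊎aboveLater : ∀ {a} → suc a < length σ → BelowLater σ a ⊎ AboveLater σ a
  belowLater⊎aboveLater {a} a+1< with nth σ a <? nth σ (suc a)
  ... | yes ascent  = inj₁ (ascent⇒belowLater a+1< ascent)
  ... | no  descent = inj₂ (descent⇒aboveLater a+1< descent)

  -- F(i) occupies the 0-based positions L0 … Q, and F(i-1) starts at suc Q.
  ascentFactor-extremes : ∀ {L0 Q} → L0 ≤ Q → suc (suc Q) < length σ
    → (∀ c → L0 ≤ c → c ≤ Q → nth σ c < nth σ (suc c)) → ¬ nth σ (suc Q) < nth σ (suc (suc Q))
    → LeastFrom σ L0 L0 × GreatestFrom σ L0 (suc Q)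
  ascentFactor-extremes {L0} {Q} L0≤Q Q+2< ascent descent =
    record { from = ≤-refl ; bounded = inside (m≤n⇒m≤1+n L0≤Q) ; least = least } ,
    record { from = m≤n⇒m≤1+n L0≤Q ; bounded = inside ≤-refl ; greatest = greatest }
    where
    inside : ∀ {c} → c ≤ suc Q → c < length σ
    inside c≤ = ≤-<-trans c≤ (<-trans ≤-refl Q+2<)
    least : ∀ c → L0 ≤ c → c < length σ → nth σ L0 ≤ nth σ c
    least c L0≤c c< with m≤n⇒m<n∨m≡n L0≤c
    ... | inj₁ L0<c = <⇒≤ (ascent⇒belowLater (inside (s≤s L0≤Q)) (ascent L0 ≤-refl L0≤Q) c L0<c c<)
    ... | inj₂ refl = ≤-refl
    greatest : ∀ c → L0 ≤ c → c < length σ → nth σ c ≤ nth σ (suc Q)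
    greatest c L0≤c c< with <-cmp c (suc Q)
    ... | tri< c<Q+1 _ _ =
      <⇒≤ (ascent⇒belowLater (inside c<Q+1) (ascent c L0≤c (s≤s⁻¹ c<Q+1)) (suc Q) c<Q+1 (inside ≤-refl))
    ... | tri≈ _ refl _  = ≤-refl
    ... | tri> _ _ Q+1<c = <⇒≤ (descent⇒aboveLater Q+2< descent c Q+1<c c<)

  descentFactor-extremes : ∀ {L0 Q} → L0 ≤ Q → suc (suc Q) < length σ
    → (∀ c → L0 ≤ c → c ≤ Q → ¬ nth σ c < nth σ (suc c)) → nth σ (suc Q) < nth σ (suc (suc Q))
    → LeastFrom σ L0 (suc Q) × GreatestFrom σ L0 L0
  descentFactor-extremes {L0} {Q} L0≤Q Q+2< descent ascent =
    record { from = m≤n⇒m≤1+n L0≤Q ; bounded = inside ≤-refl ; least = least } ,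
    record { from = ≤-refl ; bounded = inside (m≤n⇒m≤1+n L0≤Q) ; greatest = greatest }
    where
    inside : ∀ {c} → c ≤ suc Q → c < length σ
    inside c≤ = ≤-<-trans c≤ (<-trans ≤-refl Q+2<)
    greatest : ∀ c → L0 ≤ c → c < length σ → nth σ c ≤ nth σ L0
    greatest c L0≤c c< with m≤n⇒m<n∨m≡n L0≤c
    ... | inj₁ L0<c = <⇒≤ (descent⇒aboveLater (inside (s≤s L0≤Q)) (descent L0 ≤-refl L0≤Q) c L0<c c<)
    ... | inj₂ refl = ≤-refl
    least : ∀ c → L0 ≤ c → c < length σ → nth σ (suc Q) ≤ nth σ c
    least c L0≤c c< with <-cmp c (suc Q)
    ... | tri< c<Q+1 _ _ =
      <⇒≤ (descent⇒aboveLater (inside c<Q+1) (descent c L0≤c (s≤s⁻¹ c<Q+1)) (suc Q) c<Q+1 (inside ≤-refl))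
    ... | tri≈ _ refl _  = ≤-refl
    ... | tri> _ _ Q+1<c = <⇒≤ (ascent⇒belowLater Q+2< ascent c Q+1<c c<)

  ascent-condA⇔condB : ∀ {π L P L0 Q j′ s} → Unique π → j′ < length π
    → L ≡ suc L0 → P ≡ suc (suc Q) → L0 ≤ Q → suc (suc Q) < length σ
    → (∀ c → L0 ≤ c → c ≤ Q → nth σ c < nth σ (suc c)) → ¬ nth σ (suc Q) < nth σ (suc (suc Q))
    → InSETAt σ π L (suc j′) s
    → (∀ s′ → InSETAt σ π L (suc j′) s′ → elemFAt L P s ≤ elemFAt L P s′)
    → CondAAt σ π L (suc j′) ⇔ CondBAt σ π L (suc j′) s
  ascent-condA⇔condB {π} {L0 = L0} {Q} {j′} {s} π-unique j′< refl refl L0≤Q Q+2< ascent descent s∈ s-minimal =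
    mk⇔ (condA⇒condB π-unique j′< least greatest belowLater⊎aboveLater s∈ bounds)
        (condB⇒condA {σ} {π} {suc L0} {suc j′} {s})
    where
    extremes : LeastFrom σ L0 L0 × GreatestFrom σ L0 (suc Q)
    extremes = ascentFactor-extremes L0≤Q Q+2< ascent descent
    least = proj₁ extremes
    greatest = proj₂ extremes
    L0< : L0 < length σ
    L0< = LeastFrom.bounded least
    bounds : ∀ u → IsMatching σ π u → nth u L0 ≡ nth π j′
           → nth u L0 ≤ nth s (L0 ∸ L0) × nth s (suc Q ∸ L0) ≤ nth u (suc Q)
    bounds u u-matching u[L0]≡π[j′] =
      ≤-reflexive (matching-head≡SET-head {σ} {π} {u} {L0} {j′} {s} s∈ u[L0]≡π[j′]) ,
      ≤-trans (s-minimal (drop L0 u) (drop-∈SET {σ} {π} {u} π-unique u-matching L0< j′< u[L0]≡π[j′]))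
              (≤-reflexive (nth-drop-∸ u (GreatestFrom.from greatest)))

  descent-condA⇔condB : ∀ {π L P L0 Q j′ s} → Unique π → j′ < length π
    → L ≡ suc L0 → P ≡ suc (suc Q) → L0 ≤ Q → suc (suc Q) < length σ
    → (∀ c → L0 ≤ c → c ≤ Q → ¬ nth σ c < nth σ (suc c)) → nth σ (suc Q) < nth σ (suc (suc Q))
    → InSETAt σ π L (suc j′) s
    → (∀ s′ → InSETAt σ π L (suc j′) s′ → elemFAt L P s′ ≤ elemFAt L P s)
    → CondAAt σ π L (suc j′) ⇔ CondBAt σ π L (suc j′) s
  descent-condA⇔condB {π} {L0 = L0} {Q} {j′} {s} π-unique j′< refl refl L0≤Q Q+2< descent ascent s∈ s-maximal =
    mk⇔ (condA⇒condB π-unique j′< least greatest belowLater⊎aboveLater s∈ bounds)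
        (condB⇒condA {σ} {π} {suc L0} {suc j′} {s})
    where
    extremes : LeastFrom σ L0 (suc Q) × GreatestFrom σ L0 L0
    extremes = descentFactor-extremes L0≤Q Q+2< descent ascent
    least = proj₁ extremes
    greatest = proj₂ extremes
    L0< : L0 < length σ
    L0< = GreatestFrom.bounded greatest
    bounds : ∀ u → IsMatching σ π u → nth u L0 ≡ nth π j′
           → nth u (suc Q) ≤ nth s (suc Q ∸ L0) × nth s (L0 ∸ L0) ≤ nth u L0
    bounds u u-matching u[L0]≡π[j′] =
      ≤-trans (≤-reflexive (sym (nth-drop-∸ u (LeastFrom.from least))))
              (s-maximal (drop L0 u) (drop-∈SET {σ} {π} {u} π-unique u-matching L0< j′< u[L0]≡π[j′])) ,
      ≤-reflexive (sym (matching-head≡SET-head {σ} {π} {u} {L0} {j′} {s} s∈ u[L0]≡π[j′]))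

-- Factors

suc-upTo-increasing : ∀ k → AllPairs _<_ (map suc (upTo k))
suc-upTo-increasing k = AllPairsₚ.map⁺ (AllPairsₚ.applyUpTo⁺₁ (λ x → x) k (λ i<j _ → s<s i<j))

perm-unique : ∀ {k xs} → IsPerm k xs → Unique xs
perm-unique {k} xs↭ = Unique-resp-↭ (↭⇒↭ₛ (↭-sym xs↭)) (AllPairs.map <⇒≢ (suc-upTo-increasing k))

perm-length : ∀ {k xs} → IsPerm k xs → length xs ≡ k
perm-length {k} xs↭ = trans (↭-length xs↭) (trans (length-map suc (upTo k)) (length-upTo k))

sorted-nth-< : ∀ {xs a b} → AllPairs _<_ xs → a < b → b < length xs → nth xs a < nth xs b
sorted-nth-< {x ∷ xs} {zero}  {suc b} (x< ∷ _)      _         (s≤s b<) = All.lookup x< (nth-∈ xs b<)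
sorted-nth-< {x ∷ xs} {suc a} {suc b} (_ ∷ sorted) (s≤s a<b) (s≤s b<) = sorted-nth-< sorted a<b b<

starts-sorted : ∀ σ → AllPairs _<_ (starts σ)
starts-sorted σ = AllPairsₚ.filter⁺ (λ r → T? (isStartᵇ σ r)) (suc-upTo-increasing (length σ))

∈starts⇒isStart : ∀ {σ r} → r ∈ starts σ → T (isStartᵇ σ r)
∈starts⇒isStart {σ} r∈ = proj₂ (∈-filter⁻ (λ r → T? (isStartᵇ σ r)) {xs = map suc (upTo (length σ))} r∈)

AscentTypeFlips : List ℕ → ℕ → Set
AscentTypeFlips σ r = (Asc σ r → ¬ Asc σ (suc r)) × (¬ Asc σ r → Asc σ (suc r))

T-xor⇒flips : ∀ {x y} → T (x xor y) → (T x → ¬ T y) × (¬ T x → T y)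
T-xor⇒flips {true}  {true}  ()
T-xor⇒flips {true}  {false} _ = (λ _ ()) , (λ ¬x → ⊥-elim (¬x tt))
T-xor⇒flips {false} {true}  _ = (λ ()) , (λ _ → tt)
T-xor⇒flips {false} {false} ()

isStart⇒boundary : ∀ σ Q → T (isStartᵇ σ (suc (suc Q))) → suc (suc Q) < length σ × AscentTypeFlips σ (suc Q)
isStart⇒boundary σ Q start =
  let (in-range , switch) = Equivalence.to T-∧ start
      (flips⁺ , flips⁻) = T-xor⇒flips switch
  in <ᵇ⇒< _ _ in-range ,
     (λ ascent next → flips⁺ (<⇒<ᵇ ascent) (<⇒<ᵇ next)) ,
     (λ ¬ascent → <ᵇ⇒< _ _ (flips⁻ (¬ascent ∘ <ᵇ⇒< _ _)))

lme-consecutive : ∀ σ i → 2 ≤ i → i ≤ numFactors σ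
  → LME σ i < LME σ (i ∸ 1) × LME σ i ∈ starts σ × LME σ (i ∸ 1) ∈ starts σ
lme-consecutive σ (suc (suc i)) (s≤s (s≤s z≤n)) i≤m =
  sorted-nth-< (starts-sorted σ) earlier later< ,
  nth-∈ (starts σ) (<-trans earlier later<) ,
  nth-∈ (starts σ) later<
  where
  m = numFactors σ
  earlier : m ∸ suc (suc i) < m ∸ suc i
  earlier = ∸-monoʳ-< ≤-refl i≤m
  later< : m ∸ suc i < m
  later< = ∸-monoʳ-< z<s (≤-trans (n≤1+n _) i≤m)

-- F(i) occupies the 1-based positions suc L0 … suc Q.
factor-boundary : ∀ σ i → 2 ≤ i → i ≤ numFactors σ
  → ∃[ L0 ] ∃[ Q ] (LME σ i ≡ suc L0 × LME σ (i ∸ 1) ≡ suc (suc Q) × L0 ≤ Q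
                   × suc (suc Q) < length σ × AscentTypeFlips σ (suc Q))
factor-boundary σ i 2≤i i≤m with LME σ i | LME σ (i ∸ 1) | lme-consecutive σ i 2≤i i≤m
... | zero   | _           | _ , zero∈ , _ = ⊥-elim (∈starts⇒isStart {σ} zero∈)
... | suc L0 | suc (suc Q) | s≤s (s≤s L0≤Q) , _ , next∈ =
  L0 , Q , refl , refl , L0≤Q , isStart⇒boundary σ Q (∈starts⇒isStart {σ} next∈)

factor-interior : ∀ {σ i L0 Q} {R : ℕ → Set} → LME σ i ≡ suc L0 → LME σ (i ∸ 1) ≡ suc (suc Q)
  → suc (suc Q) < length σ → (∀ r → InFactor σ i r → r < length σ → R r)
  → ∀ c → L0 ≤ c → c ≤ Q → R (suc c)
factor-interior {σ} eL eP Q+2< holds c L0≤c c≤Q =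
  holds (suc c) (subst (_≤ suc c) (sym eL) (s≤s L0≤c) , <⇒≤ c+1< , inj₂ (subst (suc c <_) (sym eP) (s≤s (s≤s c≤Q))))
        c+1<
  where
  c+1< : suc c < length σ
  c+1< = <-trans (s≤s (s≤s c≤Q)) Q+2<

corollary4 : (k n : ℕ) (σ π : List ℕ) → IsPerm k σ → IsPerm n π
    → Avoids σ pat213 → Avoids σ pat231
    → (i j : ℕ) → 2 ≤ i → i ≤ numFactors σ → 1 ≤ j → j ≤ n
    → (∃[ s ] InSET σ π i j s)
    → ((AscentFactor σ i → (s : List ℕ) → InSET σ π i j s
          → ((s′ : List ℕ) → InSET σ π i j s′ → elemF σ i s ≤ elemF σ i s′)
          → (CondA σ π i j ⇔ CondB σ π i j s))
       × (DescentFactor σ i → (s : List ℕ) → InSET σ π i j s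
          → ((s′ : List ℕ) → InSET σ π i j s′ → elemF σ i s′ ≤ elemF σ i s)
          → (CondA σ π i j ⇔ CondB σ π i j s)))
corollary4 k n σ π σ-perm π-perm avoids-213 avoids-231 i (suc j′) 2≤i i≤m _ j≤n _
  with factor-boundary σ i 2≤i i≤m
... | L0 , Q , eL , eP , L0≤Q , Q+2< , flips⁺ , flips⁻ =
  (λ ascent-factor s →
     let ascents = factor-interior {σ} {i} eL eP Q+2< ascent-factor in
     ascent-condA⇔condB {s = s} π-unique j′< eL eP L0≤Q Q+2< ascents (flips⁺ (ascents Q L0≤Q ≤-refl))) ,
  (λ descent-factor s →
     let descents = factor-interior {σ} {i} eL eP Q+2< descent-factor in
     descent-condA⇔condB {s = s} π-unique j′< eL eP L0≤Q Q+2< descents (flips⁻ (descents Q L0≤Q ≤-refl)))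
  where
  open Avoiding (perm-unique σ-perm) avoids-213 avoids-231
  π-unique : Unique π
  π-unique = perm-unique π-perm
  j′< : j′ < length π
  j′< = subst (j′ <_) (sym (perm-length π-perm)) j≤n
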